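{- Suppose that $\textsc{Seq}$ contains only sequences that are monotonically increasing with respect to $\le_\tau$, and that $\textsc{Seq}$ has maximal limits. Moreover, let $x$ be acceptable, $\prec_B$ computably enumerable, and suppose the neighbourhood filter of each point of $T$ has an enumerable strong base of basic open sets (i.e. for each $y\in T$ there is a c.e. $E\subseteq\omega$ with $\{B_n:n\in E\}$ a strong base of $\mathcal N(y)$). Then $x$ has a limit algorithm.
   Context: Notation: $P^{(n)}$ ($R^{(n)}$) are the $n$-ary partial (total) computable functions; $\varphi$ a Gödel numbering of $P^{(1)}$; $\langle\cdot,\cdot\rangle$ a computable pairing function. A numbering of a set $S$ is a partial map from $\omega$ onto $S$. Setting: $\mathcal T=(T,\tau)$ is a countable topological $T_0$ space with countable basis $\mathcal B$, $B$ ($n\mapsto B_n$) a total numbering of $\mathcal B$, $x$ a numbering of $T$, and $\prec_B$ a transitive relation on $\omega$ with $m\prec_B n\Rightarrow B_m\subseteq B_n$ such that whenever $z\in B_m\cap B_n$ there is $a$ with $z\in B_a$, $a\prec_B m$, $a\prec_B n$. A strong base of a filter $\mathcal H$ is a nonempty set $\mathcal F\subseteq\mathcal H$ of basic open sets such that for $B_m,B_n\in\mathcal F$ some $B_a\in\mathcal F$ has $a\prec_B m$, $a\prec_B n$, and for each $B_m\in\mathcal H$ some $B_a\in\mathcal F$ has $a\prec_B m$. A normed computable enumeration of basic open sets is $(B_{f(a)})_a$ with $f\in R^{(1)}$, $f(a+1)\prec_B f(a)$ (index: Gödel number of $f$); it converges to $y$ if $\{B_{f(a)}\}$ is a strong base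 of $\mathcal N(y)$. $x$ is computable if there is a c.e. $L$ with $\langle i,n\rangle\in L\iff x_i\in B_n$ for $i\in\mathrm{dom}(x)$; $x$ allows effective limit passing if there is $pt\in P^{(1)}$ such that for each index $m$ of a normed computable enumeration converging to $y$, $pt(m)\in\mathrm{dom}(x)$ and $x_{pt(m)}=y$; $x$ is acceptable if both hold. A sequence $(y_a)_a$ in $T$ is computable if $y_a=x_{g(a)}$ for some $g\in R^{(1)}$ with range in $\mathrm{dom}(x)$; any Gödel number of $g$ is an index. Specialization order: $y\le_\tau z$ iff every $B_n$ containing $y$ contains $z$. $\mathrm{hl}(B_n)=\bigcap\{B_a:n\prec_B a\}$. $\mathrm{Lim}_a y_a$ is the set of topological limit points; convergent means nonempty. The space comes with a fixed collection $\textsc{Seq}$ of computable sequences such that: (1) every computable $\le_\tau$-monotonically increasing sequence is in $\textsc{Seq}$; (2) there is $p\in R^{(1)}$ such that for each index $m$ of a normed computable enumeration converging to $y$, $p(m)$ is an index of a sequence in $\textsc{Seq}$ with (a) $x_{\varphi_{p(m)}(a)}\in\mathrm{hl}(B_{\varphi_m(a)})$ for all $a$, (b) if $\mathcal T$ is not $T_1$, then for every basic open $B_n\notin\mathcal N(y)$ only finitely many $a$ have $x_{\varphi_{p(m)}(a)}\in B_n$; (3) if $(y_a)_a\in\textsc{Seq}$ then for every $\bar a$ the sequence equal to $y_a$ for $a<\bar a$ and $y_{\bar a}$ for $a\ge\bar a$ is in $\textsc{Seq}$. $\textsc{Seq}$ has maximal limits if $\mathrm{Lim}_a y_a$ has a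 $\le_\tau$-greatest element for each convergent $(y_a)_a\in\textsc{Seq}$. $x$ has a limit algorithm if there is $\mathrm{li}\in P^{(1)}$ such that for all indices $m,m'$ of convergent sequences in $\textsc{Seq}$: (i) $\mathrm{li}(m)$ is defined and in $\mathrm{dom}(x)$; (ii) $x_{\mathrm{li}(m)}\in\mathrm{Lim}_a x_{\varphi_m(a)}$; (iii) if $x_{\varphi_m(a)}=x_{\varphi_m(\bar a)}$ for all $a\ge\bar a$, then $x_{\mathrm{li}(m)}=x_{\varphi_m(\bar a)}$; (iv) if $\mathrm{Lim}_a x_{\varphi_m(a)}=\mathrm{Lim}_a x_{\varphi_{m'}(a)}$ then $x_{\mathrm{li}(m)}=x_{\mathrm{li}(m')}$. -}

module Defs where

open import Data.Nat using (ℕ; zero; suc; _≤_; _<_; _<?_)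
open import Data.Fin using (Fin)
open import Data.Vec using (Vec; []; _∷_; lookup)
open import Data.Product using (Σ; ∃; _×_; _,_)
open import Data.Empty using (⊥)
open import Relation.Nullary using (¬_; yes; no)
open import Relation.Binary.PropositionalEquality using (_≡_; _≢_)
open import Function.Bundles using (_⇔_)

data PR : ℕ → Set where
  zeroᶜ : ∀ {n} → PR n
  succᶜ : PR 1
  projᶜ : ∀ {n} → Fin n → PR n
  compᶜ : ∀ {n m} → PR m → Vec (PR n) m → PR n
  precᶜ : ∀ {n} → PR n → PR (suc (suc n)) → PR (suc n)
  muᶜ   : ∀ {n} → PR (suc n) → PR n

-- Eval c xs y : the function coded by c, applied to xs, converges with value y.
mutual
  data Eval : ∀ {n} → PR n → Vec ℕ n → ℕ → Set where
    ev-zero : ∀ {n} {xs : Vec ℕ n} → Eval zeroᶜ xs 0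
    ev-succ : ∀ {x} → Eval succᶜ (x ∷ []) (suc x)
    ev-proj : ∀ {n} {xs : Vec ℕ n} (i : Fin n) → Eval (projᶜ i) xs (lookup xs i)
    ev-comp : ∀ {n m} {f : PR m} {gs : Vec (PR n) m} {xs ys y} →
              EvalVec gs xs ys → Eval f ys y → Eval (compᶜ f gs) xs y
    ev-prec-z : ∀ {n} {g : PR n} {h} {xs y} →
                Eval g xs y → Eval (precᶜ g h) (0 ∷ xs) y
    ev-prec-s : ∀ {n} {g : PR n} {h} {k xs r y} →
                Eval (precᶜ g h) (k ∷ xs) r → Eval h (k ∷ r ∷ xs) y →
                Eval (precᶜ g h) (suc k ∷ xs) y
    ev-mu : ∀ {n} {f : PR (suc n)} {xs y} →
            Eval f (y ∷ xs) 0 →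
            (∀ z → z < y → ∃ λ k → Eval f (z ∷ xs) (suc k)) →
            Eval (muᶜ f) xs y

  data EvalVec : ∀ {n m} → Vec (PR n) m → Vec ℕ n → Vec ℕ m → Set where
    ev-[] : ∀ {n} {xs : Vec ℕ n} → EvalVec [] xs []
    ev-∷  : ∀ {n m} {g : PR n} {gs : Vec (PR n) m} {xs y ys} →
            Eval g xs y → EvalVec gs xs ys → EvalVec (g ∷ gs) xs (y ∷ ys)

-- Gödel numberings (acceptable numberings in Rogers' sense) of P^(1).
-- A numbering of partial unary functions is given as a relation:
-- φ e a b  means  φ_e(a) is defined and equal to b.

record GoedelNumbering (φ : ℕ → ℕ → ℕ → Set) : Set where
  field
    φ-computable : ∀ e → ∃ λ (c : PR 1) → ∀ a b → φ e a b ⇔ Eval c (a ∷ []) b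
    φ-onto : ∀ (c : PR 1) → ∃ λ e → ∀ a b → φ e a b ⇔ Eval c (a ∷ []) b
    φ-universal : ∃ λ (c : PR 2) → ∀ e a b → φ e a b ⇔ Eval c (e ∷ a ∷ []) b
    -- every computable numbering of P^(1) reduces to φ via a total computable function
    φ-smn : ∀ (c : PR 2) → ∃ λ (g : PR 1) →
              (∀ i → ∃ λ k → Eval g (i ∷ []) k) ×
              (∀ i k → Eval g (i ∷ []) k → ∀ a b → Eval c (i ∷ a ∷ []) b ⇔ φ k a b)

record PairingFunction (pair : ℕ → ℕ → ℕ) : Set where
  field
    pair-computable : ∃ λ (c : PR 2) → ∀ a b → Eval c (a ∷ b ∷ []) (pair a b)
    pair-injective : ∀ a b a' b' → pair a b ≡ pair a' b' → (a ≡ a') × (b ≡ b')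
    pair-surjective : ∀ k → ∃ λ a → ∃ λ b → pair a b ≡ k

record Space : Set₁ where
  field
    φ       : ℕ → ℕ → ℕ → Set
    φ-gn    : GoedelNumbering φ
    pair    : ℕ → ℕ → ℕ
    pair-ok : PairingFunction pair
    -- the space T with basis (B_n)_n; B n y means y ∈ B_n
    T       : Set
    B       : ℕ → T → Set
    B-covers : ∀ y → ∃ λ n → B n y
    T₀      : ∀ y z → (∀ n → B n y ⇔ B n z) → y ≡ z
    -- the numbering x of T; X i y means i ∈ dom(x) and x_i = y
    X       : ℕ → T → Set
    X-functional : ∀ i y z → X i y → X i z → y ≡ z
    X-onto  : ∀ y → ∃ λ i → X i y
    _≺_     : ℕ → ℕ → Set
    ≺-trans : ∀ l m n → l ≺ m → m ≺ n → l ≺ n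
    ≺-⊆     : ∀ m n → m ≺ n → ∀ z → B m z → B n z
    ≺-refine : ∀ m n z → B m z → B n z → ∃ λ a → B a z × a ≺ m × a ≺ n

module _ (S : Space) where
  open Space S

  Total : ℕ → Set
  Total e = ∀ a → ∃ λ b → φ e a b

  CE : (ℕ → Set) → Set
  CE L = ∃ λ e → ∀ k → L k ⇔ (∃ λ b → φ e k b)

  _≤τ_ : T → T → Set
  y ≤τ z = ∀ n → B n y → B n z

  hl : ℕ → T → Set
  hl n z = ∀ a → n ≺ a → B a z

  StrongBase : (ℕ → Set) → T → Set
  StrongBase E y =
    (∃ λ n → E n) ×
    (∀ n → E n → B n y) ×
    (∀ m n → E m → E n → ∃ λ a → E a × a ≺ m × a ≺ n) ×
    (∀ m → B m y → ∃ λ a → E a × a ≺ m)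

  NormedEnum : ℕ → Set
  NormedEnum m = Total m × (∀ a b c → φ m a b → φ m (suc a) c → c ≺ b)

  ConvergesTo : ℕ → T → Set
  ConvergesTo m y = NormedEnum m × StrongBase (λ n → ∃ λ a → φ m a n) y

  IsIndex : ℕ → (ℕ → T) → Set
  IsIndex m s = ∀ a → ∃ λ j → φ m a j × X j (s a)

  Lim : (ℕ → T) → T → Set
  Lim s y = ∀ n → B n y → ∃ λ N → ∀ a → N ≤ a → B n (s a)

  Convergent : (ℕ → T) → Set
  Convergent s = ∃ λ y → Lim s y

  IsT₁ : Set
  IsT₁ = ∀ y z → y ≢ z → ∃ λ n → B n y × ¬ B n z

  Monotone : (ℕ → T) → Set
  Monotone s = ∀ a → s a ≤τ s (suc a)

  freezeAt : (ℕ → T) → ℕ → (ℕ → T)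
  freezeAt s ā a with a <? ā
  ... | yes _ = s a
  ... | no  _ = s ā

  XComputable : Set₁
  XComputable = ∃ λ (L : ℕ → Set) → CE L ×
                  (∀ i y n → X i y → (L (pair i n) ⇔ B n y))

  EffectiveLimitPassing : Set
  EffectiveLimitPassing = ∃ λ e → ∀ m y → ConvergesTo m y →
                            ∃ λ j → φ e m j × X j y

  Acceptable : Set₁
  Acceptable = XComputable × EffectiveLimitPassing

  ≺-CE : Set
  ≺-CE = CE (λ k → ∃ λ m → ∃ λ n → (k ≡ pair m n) × (m ≺ n))

  EnumerableStrongBases : Set₁
  EnumerableStrongBases = ∀ y → ∃ λ (E : ℕ → Set) → CE E × StrongBase E y

  record SeqSystem : Set₁ where
    field
      Seq : (ℕ → T) → Set
      Seq-ext : ∀ s s' → (∀ a → s a ≡ s' a) → Seq s → Seq s'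
      Seq-computable : ∀ s → Seq s → ∃ λ m → IsIndex m s
      Seq-monotone : ∀ s m → IsIndex m s → Monotone s → Seq s
      Seq-p : ∃ λ pe → Total pe × (∀ m y → ConvergesTo m y →
                ∃ λ q → φ pe m q × ∃ λ s → Seq s × IsIndex q s ×
                  (∀ a n → φ m a n → hl n (s a)) ×
                  (¬ IsT₁ → ∀ n → ¬ B n y →
                     ∃ λ N → ∀ a → N ≤ a → ¬ B n (s a)))
      Seq-freeze : ∀ s ā → Seq s → Seq (freezeAt s ā)

  module _ (Q : SeqSystem) where
    open SeqSystem Q

    OnlyMonotone : Set
    OnlyMonotone = ∀ s → Seq s → Monotone s

    MaximalLimits : Set
    MaximalLimits = ∀ s → Seq s → Convergent s →
                    ∃ λ y → Lim s y × (∀ z → Lim s z → z ≤τ y)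

    LimitAlgorithm : Set
    LimitAlgorithm = ∃ λ li →
      (∀ m s → Seq s → IsIndex m s → Convergent s →
         ∃ λ j → φ li m j × ∃ λ y → X j y × Lim s y ×
           (∀ ā → (∀ a → ā ≤ a → s a ≡ s ā) → y ≡ s ā)) ×
      (∀ m m' s s' → Seq s → IsIndex m s → Convergent s →
         Seq s' → IsIndex m' s' → Convergent s' →
         (∀ y → Lim s y ⇔ Lim s' y) →
         ∀ j j' y y' → φ li m j → φ li m' j' → X j y → X j' y' → y ≡ y')

module Submission where

-- Let m index a convergent sequence s ∈ Seq with greatest limit y.  As s is
-- monotone, each term s a is itself a limit of s, so s a ≤τ y; hence the
-- basic opens containing some term of s are exactly the neighbourhoods of y.
-- This set is c.e. uniformly in m (x is computable) and ≺ is c.e., so a search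
-- computes, uniformly in m, a ≺-decreasing sequence f whose (k+1)-st element
-- refines every neighbourhood enumerated by stage k: a normed computable
-- enumeration converging to y.  The effective limit passing pt applied to an
-- index of f (obtained by s-m-n) is li(m).  Property (iii) holds since an
-- eventually constant monotone sequence has its final value as greatest
-- limit, and (iv) since the greatest limit is determined by the set of limits.
--
-- Codes are μ-recursive terms, so enumerating c.e. sets stage by stage needs a
-- clocked interpreter.

open import Data.Nat using (ℕ; zero; suc; _+_; _≤_; _<_; _∸_; _⊔_; z≤n; s≤s; pred)
open import Data.Nat.Properties
open import Data.Fin using (Fin; #_; _↑ʳ_) renaming (zero to fz; suc to fs)
open import Data.Vec using (Vec; []; _∷_; _++_; lookup; map; tabulate)
open import Data.Vec.Properties using (tabulate∘lookup; tabulate-cong; lookup-++ʳ)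
open import Data.Product using (∃; _×_; _,_; proj₁; proj₂)
open import Data.Sum using (inj₁; inj₂)
open import Data.Empty using (⊥-elim)
open import Relation.Binary using (tri<; tri≈; tri>)
open import Relation.Binary.PropositionalEquality
open import Function.Bundles using (_⇔_; Equivalence; mk⇔)
open import Defs

open Equivalence using (to; from)

mutual
  eval-functional : ∀ {n} {c : PR n} {xs y y'} → Eval c xs y → Eval c xs y' → y ≡ y'
  eval-functional ev-zero ev-zero = refl
  eval-functional ev-succ ev-succ = refl
  eval-functional (ev-proj i) (ev-proj .i) = refl
  eval-functional (ev-comp p q) (ev-comp p' q') with evalVec-functional p p'
  ... | refl = eval-functional q q'
  eval-functional (ev-prec-z p) (ev-prec-z p') = eval-functional p p'
  eval-functional (ev-prec-s p q) (ev-prec-s p' q') with eval-functional p p'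
  ... | refl = eval-functional q q'
  eval-functional (ev-mu {y = y} p below) (ev-mu {y = y'} p' below') with <-cmp y y'
  ... | tri≈ _ y≡y' _ = y≡y'
  ... | tri< y<y' _ _ = ⊥-elim (1+n≢0 (eval-functional (proj₂ (below' y y<y')) p))
  ... | tri> _ _ y'<y = ⊥-elim (1+n≢0 (eval-functional (proj₂ (below y' y'<y)) p'))

  evalVec-functional : ∀ {n m} {gs : Vec (PR n) m} {xs ys ys'} →
                       EvalVec gs xs ys → EvalVec gs xs ys' → ys ≡ ys'
  evalVec-functional ev-[] ev-[] = refl
  evalVec-functional (ev-∷ p ps) (ev-∷ q qs) = cong₂ _∷_ (eval-functional p q) (evalVec-functional ps qs)

-- Truth values are coded by naturals, "positive" meaning true.
-- `ifPos a b c` is the case distinction on a code, `_and_` the conjunction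
-- and `isZero` the negation.
ifPos : ℕ → ℕ → ℕ → ℕ
ifPos zero    b c = c
ifPos (suc _) b c = b

_and_ : ℕ → ℕ → ℕ
a and b = ifPos a b 0

isZero : ℕ → ℕ
isZero a = ifPos a 0 1

and-elim : ∀ a b → a and b ≢ 0 → a ≢ 0 × b ≢ 0
and-elim zero    b h = ⊥-elim (h refl)
and-elim (suc a) b h = 1+n≢0 , h

and-intro : ∀ a b → a ≢ 0 → b ≢ 0 → a and b ≢ 0
and-intro zero    b ha hb = ⊥-elim (ha refl)
and-intro (suc a) b ha hb = hb

and-false : ∀ a b → a ≢ 0 → a and b ≡ 0 → b ≡ 0
and-false zero    b ha e = ⊥-elim (ha refl)
and-false (suc a) b ha e = e

isZero-pos : ∀ a → isZero a ≢ 0 → a ≡ 0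
isZero-pos zero    h = refl
isZero-pos (suc a) h = ⊥-elim (h refl)

isZero-zero : ∀ a → isZero a ≡ 0 → a ≢ 0
isZero-zero zero    () 
isZero-zero (suc a) _ ()

isZero-of-pos : ∀ a → a ≢ 0 → isZero a ≡ 0
isZero-of-pos zero    h = ⊥-elim (h refl)
isZero-of-pos (suc a) h = refl

Eventually : (ℕ → Set) → Set
Eventually P = ∃ λ t₀ → ∀ t → t₀ ≤ t → P t

eventually-map : ∀ {P Q : ℕ → Set} → (∀ t → P t → Q t) → Eventually P → Eventually Q
eventually-map f (t₀ , h) = t₀ , λ t le → f t (h t le)

eventually-both : ∀ {P Q : ℕ → Set} → Eventually P → Eventually Q → Eventually (λ t → P t × Q t)
eventually-both (t₀ , p) (t₁ , q) =
  t₀ ⊔ t₁ , λ t le → p t (≤-trans (m≤m⊔n t₀ t₁) le) , q t (≤-trans (m≤n⊔m t₀ t₁) le)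

eventually-beyond : ∀ n → Eventually (λ t → n ≤ t)
eventually-beyond n = n , λ t le → le

eventually-witness : ∀ {P : ℕ → Set} → Eventually P → ∃ P
eventually-witness (t₀ , h) = t₀ , h t₀ ≤-refl

eventually-assuming : ∀ {P : ℕ → Set} a → (a ≢ 0 → Eventually P) → Eventually (λ t → a ≢ 0 → P t)
eventually-assuming zero    h = 0 , λ t _ a≢0 → ⊥-elim (a≢0 refl)
eventually-assuming (suc a) h = eventually-map (λ t p _ → p) (h 1+n≢0)

eventually-below : ∀ b (P : ℕ → ℕ → Set) → (∀ z → z < b → Eventually (P z)) →
                   Eventually (λ t → ∀ z → z < b → P z t)
eventually-below zero    P h = 0 , λ t _ z ()
eventually-below (suc b) P h =
  eventually-map combine
    (eventually-both (eventually-below b P (λ z z<b → h z (m<n⇒m<1+n z<b))) (h b ≤-refl))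
  where
    combine : ∀ t → (∀ z → z < b → P z t) × P b t → ∀ z → z < suc b → P z t
    combine t (below , atb) z z<1+b with m<1+n⇒m<n∨m≡n z<1+b
    ... | inj₁ z<b  = below z z<b
    ... | inj₂ refl = atb

comp₁ : ∀ {n} → PR 1 → PR n → PR n
comp₁ f g = compᶜ f (g ∷ [])

comp₂ : ∀ {n} → PR 2 → PR n → PR n → PR n
comp₂ f g h = compᶜ f (g ∷ h ∷ [])

comp₃ : ∀ {n} → PR 3 → PR n → PR n → PR n → PR n
comp₃ f g h k = compᶜ f (g ∷ h ∷ k ∷ [])

eval-comp₁ : ∀ {n} {f : PR 1} {g : PR n} {xs a b} →
             Eval g xs a → Eval f (a ∷ []) b → Eval (comp₁ f g) xs b
eval-comp₁ p q = ev-comp (ev-∷ p ev-[]) q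

eval-comp₂ : ∀ {n} {f : PR 2} {g h : PR n} {xs a a' b} →
             Eval g xs a → Eval h xs a' → Eval f (a ∷ a' ∷ []) b → Eval (comp₂ f g h) xs b
eval-comp₂ p p' q = ev-comp (ev-∷ p (ev-∷ p' ev-[])) q

eval-comp₃ : ∀ {n} {f : PR 3} {g h k : PR n} {xs a a' a'' b} →
             Eval g xs a → Eval h xs a' → Eval k xs a'' → Eval f (a ∷ a' ∷ a'' ∷ []) b →
             Eval (comp₃ f g h k) xs b
eval-comp₃ p p' p'' q = ev-comp (ev-∷ p (ev-∷ p' (ev-∷ p'' ev-[]))) q

π₀ : ∀ {n} → PR (suc n)
π₀ = projᶜ (# 0)

π₁ : ∀ {n} → PR (suc (suc n))
π₁ = projᶜ (# 1)

π₂ : ∀ {n} → PR (suc (suc (suc n)))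
π₂ = projᶜ (# 2)

π₃ : ∀ {n} → PR (suc (suc (suc (suc n))))
π₃ = projᶜ (# 3)

dropᶜ : ∀ k {n} → Vec (PR (k + n)) n
dropᶜ k = tabulate (λ i → projᶜ (k ↑ʳ i))

eval-drop : ∀ {k n} (ys : Vec ℕ k) (xs : Vec ℕ n) → EvalVec (dropᶜ k) (ys ++ xs) xs
eval-drop {k} {n} ys xs =
  subst (EvalVec (dropᶜ k) (ys ++ xs))
        (trans (tabulate-cong (lookup-++ʳ ys xs)) (tabulate∘lookup xs))
        (projections (λ i → k ↑ʳ i))
  where
    projections : ∀ {m} (F : Fin m → Fin (k + n)) →
                  EvalVec (tabulate (λ i → projᶜ (F i))) (ys ++ xs) (tabulate (λ i → lookup (ys ++ xs) (F i)))
    projections {zero}  F = ev-[]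
    projections {suc m} F = ev-∷ (ev-proj (F fz)) (projections (λ i → F (fs i)))

eval-succ : ∀ {n} {g : PR n} {xs a} → Eval g xs a → Eval (comp₁ succᶜ g) xs (suc a)
eval-succ p = eval-comp₁ p ev-succ

constᶜ : ∀ {n} → ℕ → PR n
constᶜ zero    = zeroᶜ
constᶜ (suc k) = comp₁ succᶜ (constᶜ k)

eval-const : ∀ {n} k {xs : Vec ℕ n} → Eval (constᶜ k) xs k
eval-const zero    = ev-zero
eval-const (suc k) = eval-succ (eval-const k)

predᶜ : PR 1
predᶜ = precᶜ zeroᶜ π₀

eval-pred : ∀ a → Eval predᶜ (a ∷ []) (pred a)
eval-pred zero    = ev-prec-z ev-zero
eval-pred (suc a) = ev-prec-s (eval-pred a) (ev-proj fz)

ifPosᶜ : PR 3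
ifPosᶜ = precᶜ π₁ π₂

eval-ifPos : ∀ a b c → Eval ifPosᶜ (a ∷ b ∷ c ∷ []) (ifPos a b c)
eval-ifPos zero    b c = ev-prec-z (ev-proj (# 1))
eval-ifPos (suc a) b c = ev-prec-s (eval-ifPos a b c) (ev-proj (# 2))

andᶜ : ∀ {n} → PR n → PR n → PR n
andᶜ f g = comp₃ ifPosᶜ f g zeroᶜ

eval-and : ∀ {n} {f g : PR n} {xs a b} → Eval f xs a → Eval g xs b → Eval (andᶜ f g) xs (a and b)
eval-and p q = eval-comp₃ p q ev-zero (eval-ifPos _ _ _)

isZeroᶜ : PR 1
isZeroᶜ = comp₃ ifPosᶜ π₀ zeroᶜ (constᶜ 1)

eval-isZero : ∀ a → Eval isZeroᶜ (a ∷ []) (isZero a)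
eval-isZero a = eval-comp₃ (ev-proj fz) ev-zero (eval-const 1) (eval-ifPos a 0 1)

-- Truncated subtraction, by recursion on the subtrahend: (y , x) ↦ x ∸ y.
monusᶜ : PR 2
monusᶜ = precᶜ π₀ (comp₁ predᶜ π₁)

eval-monus : ∀ y x → Eval monusᶜ (y ∷ x ∷ []) (x ∸ y)
eval-monus zero    x = ev-prec-z (ev-proj fz)
eval-monus (suc y) x =
  ev-prec-s (eval-monus y x)
    (subst (Eval (comp₁ predᶜ π₁) (y ∷ (x ∸ y) ∷ x ∷ [])) (pred[m∸n]≡m∸[1+n] x y)
           (eval-comp₁ (ev-proj (# 1)) (eval-pred (x ∸ y))))

-- A clocked interpreter.  `run c t xs` is `suc y` if the computation of
-- c on xs yields y when every unbounded search is cut off after t + 1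
-- candidates, and 0 if some search was cut off.
allPos : ∀ {m} → Vec ℕ m → ℕ
allPos []       = 1
allPos (r ∷ rs) = r and allPos rs

-- One step of a clocked μ-search at candidate z whose clocked value is v:
-- 1 (give up) if v is undefined, suc (suc z) (found) if v is the value 0,
-- and 0 (continue) otherwise.
minStep : ℕ → ℕ → ℕ
minStep v z = ifPos v (ifPos (pred v) 0 (suc (suc z))) 1

mutual
  run : ∀ {n} → PR n → ℕ → Vec ℕ n → ℕ
  run zeroᶜ        t xs       = 1
  run succᶜ        t (x ∷ []) = suc (suc x)
  run (projᶜ i)    t xs       = suc (lookup xs i)
  run (compᶜ f gs) t xs       = allPos (runVec gs t xs) and run f t (map pred (runVec gs t xs))
  run (precᶜ g h)  t (k ∷ xs) = runRec g h t k xs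
  run (muᶜ f)      t xs       = pred (runMin f t xs (suc t))

  runVec : ∀ {n m} → Vec (PR n) m → ℕ → Vec ℕ n → Vec ℕ m
  runVec []       t xs = []
  runVec (g ∷ gs) t xs = run g t xs ∷ runVec gs t xs

  runRec : ∀ {n} → PR n → PR (suc (suc n)) → ℕ → ℕ → Vec ℕ n → ℕ
  runRec g h t zero    xs = run g t xs
  runRec g h t (suc k) xs = runRec g h t k xs and run h t (k ∷ pred (runRec g h t k xs) ∷ xs)

  -- the μ-search over the candidates below z: 0 while undecided
  runMin : ∀ {n} → PR (suc n) → ℕ → Vec ℕ n → ℕ → ℕ
  runMin f t xs zero    = 0
  runMin f t xs (suc z) = ifPos (runMin f t xs z) (runMin f t xs z) (minStep (run f t (z ∷ xs)) z)

allPosᶜ : ∀ {n m} → Vec (PR n) m → PR n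
allPosᶜ []       = constᶜ 1
allPosᶜ (g ∷ gs) = andᶜ g (allPosᶜ gs)

predsᶜ : ∀ {n m} → Vec (PR n) m → Vec (PR n) m
predsᶜ []       = []
predsᶜ (g ∷ gs) = comp₁ predᶜ g ∷ predsᶜ gs

minStepᶜ : PR 2
minStepᶜ = comp₃ ifPosᶜ π₀ (comp₃ ifPosᶜ (comp₁ predᶜ π₀) zeroᶜ (comp₁ succᶜ (comp₁ succᶜ π₁))) (constᶜ 1)

-- The codes of the clocked interpreter take the clock as an extra first argument.
mutual
  runᶜ : ∀ {n} → PR n → PR (suc n)
  runᶜ zeroᶜ        = constᶜ 1
  runᶜ succᶜ        = comp₁ succᶜ (comp₁ succᶜ π₁)
  runᶜ (projᶜ i)    = comp₁ succᶜ (projᶜ (fs i))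
  runᶜ (compᶜ f gs) = andᶜ (allPosᶜ (runVecᶜ gs)) (compᶜ (runᶜ f) (π₀ ∷ predsᶜ (runVecᶜ gs)))
  runᶜ (precᶜ g h)  = compᶜ (runRecᶜ g h) (π₁ ∷ π₀ ∷ dropᶜ 2)
  runᶜ (muᶜ f)      = comp₁ predᶜ (compᶜ (runMinᶜ f) (comp₁ succᶜ π₀ ∷ π₀ ∷ dropᶜ 1))

  runVecᶜ : ∀ {n m} → Vec (PR n) m → Vec (PR (suc n)) m
  runVecᶜ []       = []
  runVecᶜ (g ∷ gs) = runᶜ g ∷ runVecᶜ gs

  -- arguments (k , t , xs)
  runRecᶜ : ∀ {n} → PR n → PR (suc (suc n)) → PR (suc (suc n))
  runRecᶜ g h = precᶜ (runᶜ g) (andᶜ π₁ (compᶜ (runᶜ h) (π₂ ∷ π₀ ∷ comp₁ predᶜ π₁ ∷ dropᶜ 3)))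

  -- arguments (z , t , xs)
  runMinᶜ : ∀ {n} → PR (suc n) → PR (suc (suc n))
  runMinᶜ f = precᶜ zeroᶜ (comp₃ ifPosᶜ π₁ π₁ (comp₂ minStepᶜ (compᶜ (runᶜ f) (π₂ ∷ π₀ ∷ dropᶜ 3)) π₀))

eval-allPos : ∀ {n m} {gs : Vec (PR n) m} {xs rs} → EvalVec gs xs rs → Eval (allPosᶜ gs) xs (allPos rs)
eval-allPos ev-[]       = eval-const 1
eval-allPos (ev-∷ p ps) = eval-and p (eval-allPos ps)

eval-preds : ∀ {n m} {gs : Vec (PR n) m} {xs rs} → EvalVec gs xs rs → EvalVec (predsᶜ gs) xs (map pred rs)
eval-preds ev-[]       = ev-[]
eval-preds (ev-∷ p ps) = ev-∷ (eval-comp₁ p (eval-pred _)) (eval-preds ps)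

eval-minStep : ∀ v z → Eval minStepᶜ (v ∷ z ∷ []) (minStep v z)
eval-minStep v z =
  eval-comp₃ (ev-proj fz)
    (eval-comp₃ (eval-comp₁ (ev-proj fz) (eval-pred v)) ev-zero (eval-succ (eval-succ (ev-proj (# 1))))
                (eval-ifPos _ _ _))
    (eval-const 1) (eval-ifPos _ _ _)

mutual
  run-computable : ∀ {n} (c : PR n) t xs → Eval (runᶜ c) (t ∷ xs) (run c t xs)
  run-computable zeroᶜ        t xs       = eval-const 1
  run-computable succᶜ        t (x ∷ []) = eval-succ (eval-succ (ev-proj (# 1)))
  run-computable (projᶜ i)    t xs       = eval-succ (ev-proj (fs i))
  run-computable (compᶜ f gs) t xs       =
    eval-and (eval-allPos (runVec-computable gs t xs))
             (ev-comp (ev-∷ (ev-proj fz) (eval-preds (runVec-computable gs t xs)))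
                      (run-computable f t (map pred (runVec gs t xs))))
  run-computable (precᶜ g h)  t (k ∷ xs) =
    ev-comp (ev-∷ (ev-proj (# 1)) (ev-∷ (ev-proj fz) (eval-drop (t ∷ k ∷ []) xs))) (runRec-computable g h t k xs)
  run-computable (muᶜ f)      t xs       =
    eval-comp₁ (ev-comp (ev-∷ (eval-succ (ev-proj fz)) (ev-∷ (ev-proj fz) (eval-drop (t ∷ []) xs)))
                        (runMin-computable f t xs (suc t)))
               (eval-pred _)

  runVec-computable : ∀ {n m} (gs : Vec (PR n) m) t xs → EvalVec (runVecᶜ gs) (t ∷ xs) (runVec gs t xs)
  runVec-computable []       t xs = ev-[]
  runVec-computable (g ∷ gs) t xs = ev-∷ (run-computable g t xs) (runVec-computable gs t xs)

  runRec-computable : ∀ {n} (g : PR n) h t k xs → Eval (runRecᶜ g h) (k ∷ t ∷ xs) (runRec g h t k xs)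
  runRec-computable g h t zero    xs = ev-prec-z (run-computable g t xs)
  runRec-computable g h t (suc k) xs =
    ev-prec-s (runRec-computable g h t k xs)
      (eval-and (ev-proj (# 1))
        (ev-comp (ev-∷ (ev-proj (# 2)) (ev-∷ (ev-proj fz) (ev-∷ (eval-comp₁ (ev-proj (# 1)) (eval-pred _))
                                                           (eval-drop (k ∷ _ ∷ t ∷ []) xs))))
                 (run-computable h t (k ∷ pred (runRec g h t k xs) ∷ xs))))

  runMin-computable : ∀ {n} (f : PR (suc n)) t xs z → Eval (runMinᶜ f) (z ∷ t ∷ xs) (runMin f t xs z)
  runMin-computable f t xs zero    = ev-prec-z ev-zero
  runMin-computable f t xs (suc z) =
    ev-prec-s (runMin-computable f t xs z)
      (eval-comp₃ (ev-proj (# 1)) (ev-proj (# 1))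
        (eval-comp₂ (ev-comp (ev-∷ (ev-proj (# 2)) (ev-∷ (ev-proj fz) (eval-drop (z ∷ _ ∷ t ∷ []) xs)))
                             (run-computable f t (z ∷ xs)))
                    (ev-proj fz) (eval-minStep _ z))
        (eval-ifPos _ _ _))

mutual
  run-sound : ∀ {n} (c : PR n) t xs y → run c t xs ≡ suc y → Eval c xs y
  run-sound zeroᶜ        t xs       .0              refl = ev-zero
  run-sound succᶜ        t (x ∷ []) .(suc x)        refl = ev-succ
  run-sound (projᶜ i)    t xs       .(lookup xs i)  refl = ev-proj i
  run-sound (compᶜ f gs) t xs       y e with allPos (runVec gs t xs) in pos
  ... | suc w = ev-comp (runVec-sound gs t xs w pos) (run-sound f t _ y e)
  run-sound (precᶜ g h)  t (k ∷ xs) y e = runRec-sound g h t k xs y e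
  run-sound (muᶜ f)      t xs       y e with runMin f t xs (suc t) in found
  run-sound (muᶜ f)      t xs       y refl | suc (suc w) =
    let (zero-at-y , positive-below) = runMin-found f t xs (suc t) w found in ev-mu zero-at-y positive-below

  runVec-sound : ∀ {n m} (gs : Vec (PR n) m) t xs w → allPos (runVec gs t xs) ≡ suc w →
                 EvalVec gs xs (map pred (runVec gs t xs))
  runVec-sound []       t xs w e = ev-[]
  runVec-sound (g ∷ gs) t xs w e with run g t xs in eg
  ... | suc r = ev-∷ (run-sound g t xs r eg) (runVec-sound gs t xs w e)

  runRec-sound : ∀ {n} (g : PR n) h t k xs y → runRec g h t k xs ≡ suc y → Eval (precᶜ g h) (k ∷ xs) y
  runRec-sound g h t zero    xs y e = ev-prec-z (run-sound g t xs y e)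
  runRec-sound g h t (suc k) xs y e with runRec g h t k xs in er
  ... | suc r = ev-prec-s (runRec-sound g h t k xs r er) (run-sound h t (k ∷ r ∷ xs) y e)

  runMin-found : ∀ {n} (f : PR (suc n)) t xs z y → runMin f t xs z ≡ suc (suc y) →
                 Eval f (y ∷ xs) 0 × (∀ z' → z' < y → ∃ λ k → Eval f (z' ∷ xs) (suc k))
  runMin-found f t xs (suc z) y e with runMin f t xs z in before
  ... | suc w = runMin-found f t xs z y (trans before e)
  ... | zero with run f t (z ∷ xs) in ev
  ...   | suc zero with e
  ...     | refl = run-sound f t (z ∷ xs) 0 ev , runMin-passed f t xs z before
  runMin-found f t xs (suc z) y () | zero | suc (suc _)
  runMin-found f t xs (suc z) y () | zero | zero

  runMin-passed : ∀ {n} (f : PR (suc n)) t xs z → runMin f t xs z ≡ 0 →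
                  ∀ z' → z' < z → ∃ λ k → Eval f (z' ∷ xs) (suc k)
  runMin-passed f t xs (suc z) e z' z'<1+z with runMin f t xs z in before
  ... | zero with run f t (z ∷ xs) in ev
  ...   | suc (suc k) with m<1+n⇒m<n∨m≡n z'<1+z
  ...     | inj₁ z'<z = runMin-passed f t xs z before z' z'<z
  ...     | inj₂ refl = k , run-sound f t (z ∷ xs) (suc k) ev
  runMin-passed f t xs (suc z) () z' _ | zero | zero
  runMin-passed f t xs (suc z) () z' _ | zero | suc zero
  runMin-passed f t xs (suc z) () z' _ | suc _

allPos-suc : ∀ {m} (ys : Vec ℕ m) → allPos (map suc ys) ≡ 1
allPos-suc []       = refl
allPos-suc (y ∷ ys) = allPos-suc ys

pred-suc : ∀ {m} (ys : Vec ℕ m) → map pred (map suc ys) ≡ ys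
pred-suc []       = refl
pred-suc (y ∷ ys) = cong (y ∷_) (pred-suc ys)

runMin-undecided : ∀ {n} (f : PR (suc n)) t xs z →
                   (∀ z' → z' < z → ∃ λ k → run f t (z' ∷ xs) ≡ suc (suc k)) → runMin f t xs z ≡ 0
runMin-undecided f t xs zero    h = refl
runMin-undecided f t xs (suc z) h
  rewrite runMin-undecided f t xs z (λ z' z'<z → h z' (m<n⇒m<1+n z'<z)) | proj₂ (h z ≤-refl) = refl

runMin-stable : ∀ {n} (f : PR (suc n)) t xs z w z' → z ≤ z' → runMin f t xs z ≡ suc w → runMin f t xs z' ≡ suc w
runMin-stable f t xs z w z' le e with m≤n⇒m<n∨m≡n le
... | inj₂ refl = e
runMin-stable f t xs z w (suc z') le e | inj₁ (s≤s z≤z')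
  rewrite runMin-stable f t xs z w z' z≤z' e = refl

mutual
  run-complete : ∀ {n} {c : PR n} {xs y} → Eval c xs y → Eventually (λ t → run c t xs ≡ suc y)
  run-complete ev-zero     = 0 , λ t _ → refl
  run-complete ev-succ     = 0 , λ t _ → refl
  run-complete (ev-proj i) = 0 , λ t _ → refl
  run-complete {c = compᶜ f gs} {xs} (ev-comp {ys = ys} p q) =
    eventually-map at-stage (eventually-both (runVec-complete p) (run-complete q))
    where
      open ≡-Reasoning
      at-stage : ∀ t → runVec gs t xs ≡ map suc ys × run f t ys ≡ suc _ → run (compᶜ f gs) t xs ≡ suc _
      at-stage t (args , value) = begin
        allPos (runVec gs t xs) and run f t (map pred (runVec gs t xs))
          ≡⟨ cong (λ v → allPos v and run f t (map pred v)) args ⟩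
        allPos (map suc ys) and run f t (map pred (map suc ys))
          ≡⟨ cong₂ (λ a v → a and run f t v) (allPos-suc ys) (pred-suc ys) ⟩
        run f t ys
          ≡⟨ value ⟩
        suc _ ∎
  run-complete (ev-prec-z p) = run-complete p
  run-complete {c = precᶜ g h} {suc k ∷ xs} (ev-prec-s p q) =
    eventually-map (λ t (previous , step) → trans (cong (λ v → v and run h t (k ∷ pred v ∷ xs)) previous) step)
                   (eventually-both (run-complete p) (run-complete q))
  run-complete {c = muᶜ f} {xs} (ev-mu {y = y} p below) =
    eventually-map at-stage
      (eventually-both (run-complete p)
        (eventually-both (eventually-below y (λ z t → ∃ λ k → run f t (z ∷ xs) ≡ suc (suc k)) positive)
                         (eventually-beyond y)))
    where
      positive : ∀ z → z < y → Eventually (λ t → ∃ λ k → run f t (z ∷ xs) ≡ suc (suc k))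
      positive z z<y = let (k , ev) = below z z<y in eventually-map (λ t e → k , e) (run-complete ev)
      at-stage : ∀ t → run f t (y ∷ xs) ≡ 1 × (∀ z → z < y → ∃ λ k → run f t (z ∷ xs) ≡ suc (suc k)) × y ≤ t →
                 run (muᶜ f) t xs ≡ suc y
      at-stage t (zero-at-y , positive-below , y≤t) =
        cong pred (runMin-stable f t xs (suc y) (suc y) (suc t) (s≤s y≤t)
          (trans (cong (λ v → ifPos v v (minStep (run f t (y ∷ xs)) y)) (runMin-undecided f t xs y positive-below))
                 (cong (λ v → minStep v y) zero-at-y)))

  runVec-complete : ∀ {n m} {gs : Vec (PR n) m} {xs ys} → EvalVec gs xs ys →
                    Eventually (λ t → runVec gs t xs ≡ map suc ys)
  runVec-complete ev-[]       = 0 , λ t _ → refl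
  runVec-complete (ev-∷ p ps) =
    eventually-map (λ t (e , es) → cong₂ _∷_ e es) (eventually-both (run-complete p) (runVec-complete ps))

-- Bounded search: `firstHit p b` is the least z < b with p z positive, or b if there is none.
firstHit : (ℕ → ℕ) → ℕ → ℕ
firstHit p zero    = 0
firstHit p (suc b) = ifPos (b ∸ firstHit p b) (firstHit p b) (ifPos (p b) b (suc b))

firstHit-≤ : ∀ p b → firstHit p b ≤ b
firstHit-≤ p zero = z≤n
firstHit-≤ p (suc b) with b ∸ firstHit p b
... | suc _ = m≤n⇒m≤1+n (firstHit-≤ p b)
... | zero with p b
...   | zero  = ≤-refl
...   | suc _ = n≤1+n b

firstHit-none : ∀ p b → b ∸ firstHit p b ≡ 0 → firstHit p b ≡ b
firstHit-none p b e = ≤-antisym (firstHit-≤ p b) (m∸n≡0⇒m≤n e)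

firstHit-below : ∀ p b z → z < firstHit p b → p z ≡ 0
firstHit-below p (suc b) z lt with b ∸ firstHit p b in e
... | suc _ = firstHit-below p b z lt
... | zero with p b in pb
...   | suc _ = firstHit-below p b z (subst (z <_) (sym (firstHit-none p b e)) lt)
...   | zero with m<1+n⇒m<n∨m≡n lt
...     | inj₁ z<b  = firstHit-below p b z (subst (z <_) (sym (firstHit-none p b e)) z<b)
...     | inj₂ refl = pb

firstHit-hit : ∀ p b → firstHit p b < b → p (firstHit p b) ≢ 0
firstHit-hit p (suc b) lt with b ∸ firstHit p b in e
... | suc _ = firstHit-hit p b (m∸n≢0⇒n<m (λ e0 → 1+n≢0 (trans (sym e) e0)))
... | zero with p b in pb
...   | suc _ = λ e0 → 1+n≢0 (trans (sym pb) e0)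
...   | zero  = ⊥-elim (<-irrefl refl lt)

firstHit-found : ∀ p b z → z < b → p z ≢ 0 → firstHit p b < b
firstHit-found p b z z<b pz with m≤n⇒m<n∨m≡n (firstHit-≤ p b)
... | inj₁ lt = lt
... | inj₂ eq = ⊥-elim (pz (firstHit-below p b z (subst (z <_) (sym eq) z<b)))

-- `existsBelow p b` is positive iff p z is positive for some z < b.
existsBelow : (ℕ → ℕ) → ℕ → ℕ
existsBelow p b = b ∸ firstHit p b

existsBelow-hit : ∀ p b → existsBelow p b ≢ 0 → p (firstHit p b) ≢ 0
existsBelow-hit p b h = firstHit-hit p b (m∸n≢0⇒n<m h)

existsBelow-intro : ∀ p b z → z < b → p z ≢ 0 → existsBelow p b ≢ 0
existsBelow-intro p b z z<b pz = m<n⇒n≢0 (m<n⇒0<n∸m (firstHit-found p b z z<b pz))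

existsBelow-none : ∀ p b → existsBelow p b ≡ 0 → ∀ z → z < b → p z ≡ 0
existsBelow-none p b e z z<b = firstHit-below p b z (<-≤-trans z<b (m∸n≡0⇒m≤n e))

existsBelow-zero : ∀ p b → (∀ z → z < b → p z ≡ 0) → existsBelow p b ≡ 0
existsBelow-zero p b none with existsBelow p b in e
... | zero  = refl
... | suc _ = ⊥-elim (existsBelow-hit p b (λ e0 → 1+n≢0 (trans (sym e) e0))
                        (none _ (m∸n≢0⇒n<m (λ e0 → 1+n≢0 (trans (sym e) e0)))))

-- codes for the bounded searches; arguments (b , xs), where pc takes (z , xs)
firstHitᶜ : ∀ {n} → PR (suc n) → PR (suc n)
firstHitᶜ pc =
  precᶜ zeroᶜ (comp₃ ifPosᶜ (comp₂ monusᶜ π₁ π₀) π₁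
                           (comp₃ ifPosᶜ (compᶜ pc (π₀ ∷ dropᶜ 2)) π₀ (comp₁ succᶜ π₀)))

existsBelowᶜ : ∀ {n} → PR (suc n) → PR (suc n)
existsBelowᶜ pc = comp₂ monusᶜ (firstHitᶜ pc) π₀

eval-firstHit : ∀ {n} {pc : PR (suc n)} {xs} (p : ℕ → ℕ) → (∀ z → Eval pc (z ∷ xs) (p z)) →
                ∀ b → Eval (firstHitᶜ pc) (b ∷ xs) (firstHit p b)
eval-firstHit p hp zero = ev-prec-z ev-zero
eval-firstHit {xs = xs} p hp (suc b) =
  ev-prec-s (eval-firstHit p hp b)
    (eval-comp₃ (eval-comp₂ (ev-proj (# 1)) (ev-proj fz) (eval-monus (firstHit p b) b)) (ev-proj (# 1))
                (eval-comp₃ (ev-comp (ev-∷ (ev-proj fz) (eval-drop (b ∷ firstHit p b ∷ []) xs)) (hp b))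
                            (ev-proj fz) (eval-succ (ev-proj fz)) (eval-ifPos _ _ _))
                (eval-ifPos _ _ _))

eval-existsBelow : ∀ {n} {pc : PR (suc n)} {xs} (p : ℕ → ℕ) → (∀ z → Eval pc (z ∷ xs) (p z)) →
                   ∀ b → Eval (existsBelowᶜ pc) (b ∷ xs) (existsBelow p b)
eval-existsBelow p hp b = eval-comp₂ (eval-firstHit p hp b) (ev-proj fz) (eval-monus _ b)

eval-μ : ∀ {n} {f : PR (suc n)} {xs} (q : ℕ → ℕ) → (∀ w → Eval f (w ∷ xs) (q w)) →
         ∀ w → q w ≡ 0 → (∀ z → z < w → q z ≢ 0) → Eval (muᶜ f) xs w
eval-μ {f = f} {xs} q hq w zero-at-w positive-below =
  ev-mu (subst (Eval f (w ∷ xs)) zero-at-w (hq w)) (λ z z<w → positive z (positive-below z z<w))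
  where
    positive : ∀ z → q z ≢ 0 → ∃ λ k → Eval f (z ∷ xs) (suc k)
    positive z h with q z in e
    ... | zero  = ⊥-elim (h refl)
    ... | suc k = k , subst (Eval f (z ∷ xs)) e (hq z)

-- Unbounded search for a witness pair: given G on (c , w , xs), `searchᶜ G`
-- finds the least w for which some c ≤ w has G positive, and outputs the
-- least such c.  The auxiliary
-- `noWitnessᶜ G` on (w , xs) is positive iff no c ≤ w has G positive.
noWitnessᶜ : ∀ {n} → PR (suc (suc n)) → PR (suc n)
noWitnessᶜ G = comp₁ isZeroᶜ (compᶜ (existsBelowᶜ G) (comp₁ succᶜ π₀ ∷ π₀ ∷ dropᶜ 1))

searchᶜ : ∀ {n} → PR (suc (suc n)) → PR n
searchᶜ G = compᶜ (firstHitᶜ G) (comp₁ succᶜ (muᶜ (noWitnessᶜ G)) ∷ muᶜ (noWitnessᶜ G) ∷ dropᶜ 0)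

search-succeeds : ∀ {n} {G : PR (suc (suc n))} {xs : Vec ℕ n} (g : ℕ → ℕ → ℕ) →
                  (∀ c w → Eval G (c ∷ w ∷ xs) (g c w)) →
                  ∀ c₀ w₀ → c₀ ≤ w₀ → g c₀ w₀ ≢ 0 →
                  ∃ λ c → ∃ λ w → Eval (searchᶜ G) xs c × g c w ≢ 0
search-succeeds {G = G} {xs} g hg c₀ w₀ c₀≤w₀ hit₀ =
  firstHit (λ c → g c w) (suc w) , w , eval-search , existsBelow-hit (λ c → g c w) (suc w) (isZero-zero _ zero-at-w)
  where
    noWitness : ℕ → ℕ
    noWitness w = isZero (existsBelow (λ c → g c w) (suc w))
    eval-noWitness : ∀ w → Eval (noWitnessᶜ G) (w ∷ xs) (noWitness w)
    eval-noWitness w =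
      eval-comp₁ (ev-comp (ev-∷ (eval-succ (ev-proj fz)) (ev-∷ (ev-proj fz) (eval-drop (w ∷ []) xs)))
                          (eval-existsBelow (λ c → g c w) (λ c → hg c w) (suc w)))
                 (eval-isZero _)
    witness-at-w₀ : noWitness w₀ ≡ 0
    witness-at-w₀ = isZero-of-pos _ (existsBelow-intro (λ c → g c w₀) (suc w₀) c₀ (s≤s c₀≤w₀) hit₀)
    -- the least w with a witness, found itself by a bounded search
    isWitness : ℕ → ℕ
    isWitness w = isZero (noWitness w)
    w : ℕ
    w = firstHit isWitness (suc w₀)
    zero-at-w : noWitness w ≡ 0
    zero-at-w = isZero-pos _ (firstHit-hit isWitness (suc w₀)
                  (firstHit-found isWitness (suc w₀) w₀ ≤-refl (λ e → 1+n≢0 (trans (sym (cong isZero witness-at-w₀)) e))))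
    eval-least : Eval (muᶜ (noWitnessᶜ G)) xs w
    eval-least = eval-μ noWitness eval-noWitness w zero-at-w
                   (λ z z<w → isZero-zero _ (firstHit-below isWitness (suc w₀) z z<w))
    eval-search : Eval (searchᶜ G) xs (firstHit (λ c → g c w) (suc w))
    eval-search = ev-comp (ev-∷ (eval-succ eval-least) (ev-∷ eval-least (eval-drop [] xs)))
                          (eval-firstHit (λ c → g c w) (λ c → hg c w) (suc w))

record SemiDecision (P : Set) (g : ℕ → ℕ) : Set where
  field
    sound    : ∀ t → g t ≢ 0 → P
    complete : P → Eventually (λ t → g t ≢ 0)

module Effective (S : Space) where
  open Space S
  open GoedelNumbering φ-gn
  open PairingFunction pair-ok

  universalᶜ : PR 2
  universalᶜ = proj₁ φ-universal

  -- `φᵗ t e a` is suc b if φ_e(a) = b is computed by the clocked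
  -- interpreter within clock t, and 0 if not (yet).
  φᵗ : ℕ → ℕ → ℕ → ℕ
  φᵗ t e a = run universalᶜ t (e ∷ a ∷ [])

  φᵗᶜ : PR 3
  φᵗᶜ = runᶜ universalᶜ

  eval-φᵗ : ∀ t e a → Eval φᵗᶜ (t ∷ e ∷ a ∷ []) (φᵗ t e a)
  eval-φᵗ t e a = run-computable universalᶜ t (e ∷ a ∷ [])

  φᵗ-sound : ∀ t e a b → φᵗ t e a ≡ suc b → φ e a b
  φᵗ-sound t e a b h = from (proj₂ φ-universal e a b) (run-sound universalᶜ t _ b h)

  φᵗ-complete : ∀ {e a b} → φ e a b → Eventually (λ t → φᵗ t e a ≡ suc b)
  φᵗ-complete {e} {a} {b} p = run-complete (to (proj₂ φ-universal e a b) p)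

  φ-functional : ∀ {e a b b'} → φ e a b → φ e a b' → b ≡ b'
  φ-functional {e} {a} {b} {b'} p q =
    eval-functional (to (proj₂ φ-universal e a b) p) (to (proj₂ φ-universal e a b') q)

  ce-semidecision : ∀ {L : ℕ → Set} e → (∀ k → L k ⇔ (∃ λ b → φ e k b)) →
                    ∀ k → SemiDecision (L k) (λ t → φᵗ t e k)
  ce-semidecision {L} e ce k = record { sound = sound ; complete = complete }
    where
      sound : ∀ t → φᵗ t e k ≢ 0 → L k
      sound t h with φᵗ t e k in e₀
      ... | zero  = ⊥-elim (h refl)
      ... | suc b = from (ce k) (b , φᵗ-sound t e k b e₀)
      complete : L k → Eventually (λ t → φᵗ t e k ≢ 0)
      complete l = let (b , p) = to (ce k) l in
        eventually-map (λ t e₁ e₂ → 1+n≢0 (trans (sym e₁) e₂)) (φᵗ-complete p)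

  pairᶜ : PR 2
  pairᶜ = proj₁ pair-computable

  eval-pair : ∀ a b → Eval pairᶜ (a ∷ b ∷ []) (pair a b)
  eval-pair = proj₂ pair-computable

  ≤τ-antisym : ∀ y z → _≤τ_ S y z → _≤τ_ S z y → y ≡ z
  ≤τ-antisym y z y≤z z≤y = T₀ y z (λ n → mk⇔ (y≤z n) (z≤y n))

  monotone-≤τ : ∀ s → Monotone S s → ∀ a b → a ≤ b → _≤τ_ S (s a) (s b)
  monotone-≤τ s mono a zero    z≤n n h = h
  monotone-≤τ s mono a (suc b) le  n h with m≤n⇒m<n∨m≡n le
  ... | inj₂ refl     = h
  ... | inj₁ (s≤s le') = mono b n (monotone-≤τ s mono a b le' n h)

  monotone-term-limit : ∀ s → Monotone S s → ∀ a → Lim S s (s a)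
  monotone-term-limit s mono a n h = a , λ b a≤b → monotone-≤τ s mono a b a≤b n h

-- The stage-wise tests from which the normed enumeration is searched, and
-- their codes.  The argument m is an index of a sequence s, x_{φ_m(a)} = s a.
module StagewiseTests (S : Space) (xc : XComputable S) (pce : ≺-CE S) where
  open Space S
  open Effective S
  open PairingFunction pair-ok

  -- indices enumerating L = {⟨i , n⟩ : x_i ∈ B_n} and ≺
  eL : ℕ
  eL = proj₁ (proj₁ (proj₂ xc))

  L : ℕ → Set
  L = proj₁ xc

  L-enumeration : ∀ k → L k ⇔ (∃ λ b → φ eL k b)
  L-enumeration = proj₂ (proj₁ (proj₂ xc))

  L-basic : ∀ i y n → X i y → (L (pair i n) ⇔ B n y)
  L-basic = proj₂ (proj₂ xc)

  eP : ℕ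
  eP = proj₁ pce

  precedesᵗ : ℕ → ℕ → ℕ → ℕ
  precedesᵗ t c d = φᵗ t eP (pair c d)

  -- by stage t the index j = φ_m(a) has been computed and ⟨j , n⟩ enumerated
  -- into L, i.e. s a ∈ B_n has been confirmed
  occursᵗ : ℕ → ℕ → ℕ → ℕ → ℕ
  occursᵗ m t a n = φᵗ t m a and φᵗ t eL (pair (pred (φᵗ t m a)) n)

  -- some term s a with a ≤ t has been confirmed to lie in B_n by stage t
  enumeratedᵗ : ℕ → ℕ → ℕ → ℕ
  enumeratedᵗ m t n = existsBelow (λ a → occursᵗ m t a n) (suc t)

  -- n ≤ k was enumerated by stage k, but c ≺ n is not confirmed by stage w
  unconfirmed : ℕ → ℕ → ℕ → ℕ → ℕ → ℕ
  unconfirmed m k w c n = enumeratedᵗ m k n and isZero (precedesᵗ w c n)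

  allConfirmed : ℕ → ℕ → ℕ → ℕ → ℕ
  allConfirmed m k w c = isZero (existsBelow (unconfirmed m k w c) (suc k))

  -- c is confirmed by stage w as a valid successor of d at step k: c is
  -- enumerated, c ≺ d, and c ≺ n for every n ≤ k enumerated by stage k
  refines : ℕ → ℕ → ℕ → ℕ → ℕ → ℕ
  refines m k d c w = enumeratedᵗ m w c and (precedesᵗ w c d and allConfirmed m k w c)

  -- arguments (t , c , d)
  precedesᵗᶜ : PR 3
  precedesᵗᶜ = comp₃ φᵗᶜ π₀ (constᶜ eP) (comp₂ pairᶜ π₁ π₂)

  -- arguments (a , t , n , m)
  occursᵗᶜ : PR 4
  occursᵗᶜ = andᶜ termᶜ (comp₃ φᵗᶜ π₁ (constᶜ eL) (comp₂ pairᶜ (comp₁ predᶜ termᶜ) π₂))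
    where termᶜ = comp₃ φᵗᶜ π₁ π₃ π₀

  -- arguments (t , n , m)
  enumeratedᵗᶜ : PR 3
  enumeratedᵗᶜ = compᶜ (existsBelowᶜ occursᵗᶜ) (comp₁ succᶜ π₀ ∷ dropᶜ 0)

  -- arguments (n , c , w , k , d , m)
  unconfirmedᶜ : PR 6
  unconfirmedᶜ = andᶜ (comp₃ enumeratedᵗᶜ π₃ π₀ (projᶜ (# 5))) (comp₁ isZeroᶜ (comp₃ precedesᵗᶜ π₂ π₁ π₀))

  -- arguments (c , w , k , d , m)
  allConfirmedᶜ : PR 5
  allConfirmedᶜ = comp₁ isZeroᶜ (compᶜ (existsBelowᶜ unconfirmedᶜ) (comp₁ succᶜ π₂ ∷ dropᶜ 0))

  -- arguments (c , w , k , d , m)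
  refinesᶜ : PR 5
  refinesᶜ = andᶜ (comp₃ enumeratedᵗᶜ π₁ π₀ (projᶜ (# 4))) (andᶜ (comp₃ precedesᵗᶜ π₁ π₀ π₃) allConfirmedᶜ)

  -- arguments (c , w , m): c is enumerated by stage w
  startᶜ : PR 3
  startᶜ = comp₃ enumeratedᵗᶜ π₁ π₀ π₂

  -- arguments (k , m): the k-th element of the normed enumeration for index m
  enumerationᶜ : PR 2
  enumerationᶜ = precᶜ (searchᶜ startᶜ) (searchᶜ refinesᶜ)

  eval-precedesᵗ : ∀ t c d → Eval precedesᵗᶜ (t ∷ c ∷ d ∷ []) (precedesᵗ t c d)
  eval-precedesᵗ t c d =
    eval-comp₃ (ev-proj (# 0)) (eval-const eP) (eval-comp₂ (ev-proj (# 1)) (ev-proj (# 2)) (eval-pair c d)) (eval-φᵗ _ _ _)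

  eval-occursᵗ : ∀ a t n m → Eval occursᵗᶜ (a ∷ t ∷ n ∷ m ∷ []) (occursᵗ m t a n)
  eval-occursᵗ a t n m =
    eval-and eval-term
      (eval-comp₃ (ev-proj (# 1)) (eval-const eL)
                  (eval-comp₂ (eval-comp₁ eval-term (eval-pred _)) (ev-proj (# 2)) (eval-pair _ _)) (eval-φᵗ _ _ _))
    where
      eval-term : Eval (comp₃ φᵗᶜ π₁ π₃ π₀) (a ∷ t ∷ n ∷ m ∷ []) (φᵗ t m a)
      eval-term = eval-comp₃ (ev-proj (# 1)) (ev-proj (# 3)) (ev-proj (# 0)) (eval-φᵗ t m a)

  eval-enumeratedᵗ : ∀ t n m → Eval enumeratedᵗᶜ (t ∷ n ∷ m ∷ []) (enumeratedᵗ m t n)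
  eval-enumeratedᵗ t n m =
    ev-comp (ev-∷ (eval-succ (ev-proj (# 0))) (eval-drop [] (t ∷ n ∷ m ∷ [])))
            (eval-existsBelow (λ a → occursᵗ m t a n) (λ a → eval-occursᵗ a t n m) (suc t))

  eval-unconfirmed : ∀ n c w k d m → Eval unconfirmedᶜ (n ∷ c ∷ w ∷ k ∷ d ∷ m ∷ []) (unconfirmed m k w c n)
  eval-unconfirmed n c w k d m =
    eval-and (eval-comp₃ (ev-proj (# 3)) (ev-proj (# 0)) (ev-proj (# 5)) (eval-enumeratedᵗ k n m))
             (eval-comp₁ (eval-comp₃ (ev-proj (# 2)) (ev-proj (# 1)) (ev-proj (# 0)) (eval-precedesᵗ w c n))
                         (eval-isZero _))

  eval-allConfirmed : ∀ c w k d m → Eval allConfirmedᶜ (c ∷ w ∷ k ∷ d ∷ m ∷ []) (allConfirmed m k w c)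
  eval-allConfirmed c w k d m =
    eval-comp₁ (ev-comp (ev-∷ (eval-succ (ev-proj (# 2))) (eval-drop [] (c ∷ w ∷ k ∷ d ∷ m ∷ [])))
                        (eval-existsBelow (unconfirmed m k w c) (λ n → eval-unconfirmed n c w k d m) (suc k)))
               (eval-isZero _)

  eval-refines : ∀ c w k d m → Eval refinesᶜ (c ∷ w ∷ k ∷ d ∷ m ∷ []) (refines m k d c w)
  eval-refines c w k d m =
    eval-and (eval-comp₃ (ev-proj (# 1)) (ev-proj (# 0)) (ev-proj (# 4)) (eval-enumeratedᵗ w c m))
             (eval-and (eval-comp₃ (ev-proj (# 1)) (ev-proj (# 0)) (ev-proj (# 3)) (eval-precedesᵗ w c d))
                       (eval-allConfirmed c w k d m))

  eval-start : ∀ c w m → Eval startᶜ (c ∷ w ∷ m ∷ []) (enumeratedᵗ m w c)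
  eval-start c w m = eval-comp₃ (ev-proj (# 1)) (ev-proj (# 0)) (ev-proj (# 2)) (eval-enumeratedᵗ w c m)

module NormedEnumeration (S : Space) (xc : XComputable S) (pce : ≺-CE S)
                         (m : ℕ) (s : ℕ → Space.T S) (ix : IsIndex S m s) (mono : Monotone S s) where
  open Space S
  open Effective S
  open StagewiseTests S xc pce
  open PairingFunction pair-ok

  precedes-semidecision : ∀ c d → SemiDecision (c ≺ d) (λ t → precedesᵗ t c d)
  precedes-semidecision c d = record
    { sound    = λ t h → decode (SemiDecision.sound enumerated t h)
    ; complete = λ c≺d → SemiDecision.complete enumerated (c , d , refl , c≺d) }
    where
      enumerated : SemiDecision (∃ λ c' → ∃ λ d' → (pair c d ≡ pair c' d') × (c' ≺ d')) (λ t → precedesᵗ t c d)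
      enumerated = ce-semidecision eP (proj₂ pce) (pair c d)
      decode : (∃ λ c' → ∃ λ d' → (pair c d ≡ pair c' d') × (c' ≺ d')) → c ≺ d
      decode (c' , d' , e , r) with pair-injective c d c' d' e
      ... | refl , refl = r

  occurs-semidecision : ∀ a n → SemiDecision (B n (s a)) (λ t → occursᵗ m t a n)
  occurs-semidecision a n = record { sound = sound ; complete = complete }
    where
      sound : ∀ t → occursᵗ m t a n ≢ 0 → B n (s a)
      sound t h with φᵗ t m a in term
      ... | zero  = ⊥-elim (h refl)
      ... | suc j with ix a
      ...   | j' , φ-j' , x-j' with φ-functional (φᵗ-sound t m a j term) φ-j'
      ...     | refl = to (L-basic j (s a) n x-j') (SemiDecision.sound (ce-semidecision eL L-enumeration (pair j n)) t h)
      complete : B n (s a) → Eventually (λ t → occursᵗ m t a n ≢ 0)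
      complete h =
        let (j , φ-j , x-j) = ix a
            inL = from (L-basic j (s a) n x-j) h
        in eventually-map (λ t (term , found) → subst (λ v → v and φᵗ t eL (pair (pred v) n) ≢ 0) (sym term) found)
             (eventually-both (φᵗ-complete φ-j) (SemiDecision.complete (ce-semidecision eL L-enumeration (pair j n)) inL))

  Reached : ℕ → Set
  Reached n = ∃ λ a → B n (s a)

  enumerated-semidecision : ∀ n → SemiDecision (Reached n) (λ t → enumeratedᵗ m t n)
  enumerated-semidecision n = record
    { sound    = λ t h → let a = firstHit (λ a → occursᵗ m t a n) (suc t) in
                           a , SemiDecision.sound (occurs-semidecision a n) t (existsBelow-hit _ (suc t) h)
    ; complete = λ (a , h) →
        eventually-map (λ t (found , a≤t) → existsBelow-intro _ (suc t) a (s≤s a≤t) found)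
          (eventually-both (SemiDecision.complete (occurs-semidecision a n) h) (eventually-beyond a)) }

  enumerated-sound : ∀ t n → enumeratedᵗ m t n ≢ 0 → Reached n
  enumerated-sound t n = SemiDecision.sound (enumerated-semidecision n) t

  -- Two reached basic opens have a common reached ≺-refinement, since s is monotone.
  directed : ∀ c n → Reached c → Reached n → ∃ λ c' → Reached c' × c' ≺ c × c' ≺ n
  directed c n (a₁ , h₁) (a₂ , h₂) =
    let (c' , hc' , r₁ , r₂) = ≺-refine c n (s (a₁ ⊔ a₂)) (monotone-≤τ s mono a₁ (a₁ ⊔ a₂) (m≤m⊔n a₁ a₂) c h₁)
                                                         (monotone-≤τ s mono a₂ (a₁ ⊔ a₂) (m≤n⊔m a₁ a₂) n h₂)
    in c' , (a₁ ⊔ a₂ , hc') , r₁ , r₂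

  common-refinement : ∀ (p : ℕ → ℕ) d → Reached d → ∀ K → (∀ n → n < K → p n ≢ 0 → Reached n) →
                      ∃ λ c → Reached c × c ≺ d × (∀ n → n < K → p n ≢ 0 → c ≺ n)
  common-refinement p d reached-d zero _ =
    let (c , reached-c , c≺d , _) = directed d d reached-d reached-d in c , reached-c , c≺d , λ n ()
  common-refinement p d reached-d (suc K) reached
    with common-refinement p d reached-d K (λ n n<K → reached n (m<n⇒m<1+n n<K))
  ... | c , reached-c , c≺d , c≺below with p K in pK
  ...   | zero = c , reached-c , c≺d , refine
    where
      refine : ∀ n → n < suc K → p n ≢ 0 → c ≺ n
      refine n n<1+K h with m<1+n⇒m<n∨m≡n n<1+K
      ... | inj₁ n<K  = c≺below n n<K h
      ... | inj₂ refl = ⊥-elim (h pK)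
  ...   | suc _ with directed c K reached-c (reached K ≤-refl (λ e → 1+n≢0 (trans (sym pK) e)))
  ...     | c' , reached-c' , c'≺c , c'≺K = c' , reached-c' , ≺-trans c' c d c'≺c c≺d , refine
    where
      refine : ∀ n → n < suc K → p n ≢ 0 → c' ≺ n
      refine n n<1+K h with m<1+n⇒m<n∨m≡n n<1+K
      ... | inj₁ n<K  = ≺-trans c' c n c'≺c (c≺below n n<K h)
      ... | inj₂ refl = c'≺K

  allConfirmed-sound : ∀ k w c → allConfirmed m k w c ≢ 0 → ∀ n → n < suc k → enumeratedᵗ m k n ≢ 0 → c ≺ n
  allConfirmed-sound k w c h n n≤k enumerated =
    SemiDecision.sound (precedes-semidecision c n) w
      (isZero-zero _ (and-false _ _ enumerated (existsBelow-none _ (suc k) (isZero-pos _ h) n n≤k)))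

  allConfirmed-eventually : ∀ k c → (∀ n → n < suc k → enumeratedᵗ m k n ≢ 0 → c ≺ n) →
                            Eventually (λ w → allConfirmed m k w c ≢ 0)
  allConfirmed-eventually k c below =
    eventually-map (λ w confirmed → subst (λ v → isZero v ≢ 0)
                                      (sym (existsBelow-zero _ (suc k) (λ n n≤k → settled w n (confirmed n n≤k))))
                                      1+n≢0)
      (eventually-below (suc k) (λ n w → enumeratedᵗ m k n ≢ 0 → precedesᵗ w c n ≢ 0)
        (λ n n≤k → eventually-assuming (enumeratedᵗ m k n)
                     (λ enumerated → SemiDecision.complete (precedes-semidecision c n) (below n n≤k enumerated))))
    where
      settled : ∀ w n → (enumeratedᵗ m k n ≢ 0 → precedesᵗ w c n ≢ 0) → unconfirmed m k w c n ≡ 0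
      settled w n h with enumeratedᵗ m k n
      ... | zero  = refl
      ... | suc _ = isZero-of-pos _ (h 1+n≢0)

  Successor : ℕ → ℕ → ℕ → Set
  Successor k d c = Reached c × c ≺ d × (∀ n → n < suc k → enumeratedᵗ m k n ≢ 0 → c ≺ n)

  refines-sound : ∀ k d c w → refines m k d c w ≢ 0 → Successor k d c
  refines-sound k d c w h =
    let (enumerated , rest) = and-elim _ _ h
        (c≺d , confirmed) = and-elim _ _ rest
    in enumerated-sound w c enumerated ,
       SemiDecision.sound (precedes-semidecision c d) w c≺d ,
       allConfirmed-sound k w c confirmed

  refines-eventually : ∀ k d c → Successor k d c → Eventually (λ w → refines m k d c w ≢ 0)
  refines-eventually k d c (reached-c , c≺d , below) =
    eventually-map (λ w (e , p , a) → and-intro _ _ e (and-intro _ _ p a))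
      (eventually-both (SemiDecision.complete (enumerated-semidecision c) reached-c)
        (eventually-both (SemiDecision.complete (precedes-semidecision c d) c≺d)
                         (allConfirmed-eventually k c below)))

  search-successor : ∀ k d → Reached d → ∃ λ c → Eval (searchᶜ refinesᶜ) (k ∷ d ∷ m ∷ []) c × Successor k d c
  search-successor k d reached-d =
    let (c₀ , successor₀) = common-refinement (enumeratedᵗ m k) d reached-d (suc k) (λ n _ → enumerated-sound k n)
        (w₀ , refines₀ , c₀≤w₀) = eventually-witness (eventually-both (refines-eventually k d c₀ successor₀)
                                                                     (eventually-beyond c₀))
        (c , w , found , refines-cw) = search-succeeds (refines m k d) (λ c w → eval-refines c w k d m)
                                                       c₀ w₀ c₀≤w₀ refines₀
    in c , found , refines-sound k d c w refines-cw

  search-start : ∃ λ c → Eval (searchᶜ startᶜ) (m ∷ []) c × Reached c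
  search-start =
    let (d₀ , in-d₀) = B-covers (s 0)
        (w₀ , enumerated₀ , d₀≤w₀) = eventually-witness
          (eventually-both (SemiDecision.complete (enumerated-semidecision d₀) (0 , in-d₀)) (eventually-beyond d₀))
        (c , w , found , enumerated-c) = search-succeeds (λ c w → enumeratedᵗ m w c) (λ c w → eval-start c w m)
                                                         d₀ w₀ d₀≤w₀ enumerated₀
    in c , found , enumerated-sound w c enumerated-c

  opaque
    enumeration : ∀ k → ∃ λ d → Eval enumerationᶜ (k ∷ m ∷ []) d × Reached d
    enumeration zero =
      let (c , found , reached-c) = search-start in c , ev-prec-z found , reached-c
    enumeration (suc k) =
      let (d , eval-d , reached-d) = enumeration k
          (c , found , successor) = search-successor k d reached-d
      in c , ev-prec-s eval-d found , proj₁ successor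

  f : ℕ → ℕ
  f k = proj₁ (enumeration k)

  eval-f : ∀ k → Eval enumerationᶜ (k ∷ m ∷ []) (f k)
  eval-f k = proj₁ (proj₂ (enumeration k))

  f-reached : ∀ k → Reached (f k)
  f-reached k = proj₂ (proj₂ (enumeration k))

  -- f (k+1) is the successor found from f k, as evaluation is deterministic.
  f-successor : ∀ k → Successor k (f k) (f (suc k))
  f-successor k =
    let (c , found , successor) = search-successor k (f k) (f-reached k)
    in subst (Successor k (f k)) (eval-functional (ev-prec-s (eval-f k) found) (eval-f (suc k))) successor

  f-decreasing : ∀ i j → i < j → f j ≺ f i
  f-decreasing i (suc j) i<1+j with m<1+n⇒m<n∨m≡n i<1+j
  ... | inj₂ refl = proj₁ (proj₂ (f-successor j))
  ... | inj₁ i<j  = ≺-trans (f (suc j)) (f j) (f i) (proj₁ (proj₂ (f-successor j))) (f-decreasing i j i<j)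

  f-cofinal : ∀ n → Reached n → ∃ λ k → f k ≺ n
  f-cofinal n reached-n =
    let (t , enumerated , n≤t) = eventually-witness
          (eventually-both (SemiDecision.complete (enumerated-semidecision n) reached-n) (eventually-beyond n))
    in suc t , proj₂ (proj₂ (f-successor t)) n (s≤s n≤t) enumerated

  converges : ∀ y → (∀ n → Reached n ⇔ B n y) → ∀ idx → (∀ a b → φ idx a b ⇔ Eval enumerationᶜ (a ∷ m ∷ []) b) →
              ConvergesTo S idx y
  converges y reached⇔nbhd idx computes =
    (total , normed) , (f 0 , 0 , φ-f 0) , in-nbhd , directed-base , cofinal
    where
      φ-f : ∀ a → φ idx a (f a)
      φ-f a = from (computes a (f a)) (eval-f a)
      φ-is-f : ∀ {a b} → φ idx a b → b ≡ f a
      φ-is-f {a} {b} p = eval-functional (to (computes a b) p) (eval-f a)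
      total : Total S idx
      total a = f a , φ-f a
      normed : ∀ a b c → φ idx a b → φ idx (suc a) c → c ≺ b
      normed a b c p q rewrite φ-is-f p | φ-is-f q = proj₁ (proj₂ (f-successor a))
      in-nbhd : ∀ n → (∃ λ a → φ idx a n) → B n y
      in-nbhd n (a , p) rewrite φ-is-f p = to (reached⇔nbhd (f a)) (f-reached a)
      directed-base : ∀ n n' → (∃ λ a → φ idx a n) → (∃ λ a → φ idx a n') →
                      ∃ λ c → (∃ λ a → φ idx a c) × c ≺ n × c ≺ n'
      directed-base n n' (a , p) (b , q) rewrite φ-is-f p | φ-is-f q =
        f (suc (a ⊔ b)) , (suc (a ⊔ b) , φ-f _) ,
        f-decreasing a (suc (a ⊔ b)) (s≤s (m≤m⊔n a b)) , f-decreasing b (suc (a ⊔ b)) (s≤s (m≤n⊔m a b))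
      cofinal : ∀ n → B n y → ∃ λ c → (∃ λ a → φ idx a c) × c ≺ n
      cofinal n h = let (k , fk≺n) = f-cofinal n (from (reached⇔nbhd n) h) in f k , (k , φ-f k) , fk≺n

-- The limit algorithm li(m) = pt(g(m)), where g(m) is an index of the normed
-- enumeration built from the sequence with index m and pt is the effective
-- limit passing of x.
module LimitAlgorithmConstruction (S : Space) (Q : SeqSystem S) (only-monotone : OnlyMonotone S Q)
                                  (maximal : MaximalLimits S Q) (acc : Acceptable S) (pce : ≺-CE S) where
  open Space S
  open SeqSystem Q
  open GoedelNumbering φ-gn
  open Effective S
  open StagewiseTests S (proj₁ acc) pce

  -- arguments (m , k)
  enumerationOfᶜ : PR 2
  enumerationOfᶜ = comp₂ enumerationᶜ π₁ π₀

  -- g(m) is an index of k ↦ f_m(k), by s-m-n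
  gᶜ : PR 1
  gᶜ = proj₁ (φ-smn enumerationOfᶜ)

  g-total : ∀ m → ∃ λ idx → Eval gᶜ (m ∷ []) idx
  g-total = proj₁ (proj₂ (φ-smn enumerationOfᶜ))

  g-enumeration : ∀ m idx → Eval gᶜ (m ∷ []) idx → ∀ a b → φ idx a b ⇔ Eval enumerationᶜ (a ∷ m ∷ []) b
  g-enumeration m idx eval-idx a b =
    let spec = proj₂ (proj₂ (φ-smn enumerationOfᶜ)) m idx eval-idx a b
    in mk⇔ (λ p → eval-reorder (from spec p)) (λ e → to spec (eval-comp₂ (ev-proj (# 1)) (ev-proj (# 0)) e))
    where
      eval-reorder : ∀ {b} → Eval enumerationOfᶜ (m ∷ a ∷ []) b → Eval enumerationᶜ (a ∷ m ∷ []) b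
      eval-reorder (ev-comp (ev-∷ (ev-proj _) (ev-∷ (ev-proj _) ev-[])) e) = e

  pt : ℕ
  pt = proj₁ (proj₂ acc)

  pt-limit : ∀ idx y → ConvergesTo S idx y → ∃ λ j → φ pt idx j × X j y
  pt-limit = proj₂ (proj₂ acc)

  -- arguments (i , m): the dummy i is the parameter fixed to 0 by the s-m-n property
  liᶜ : PR 2
  liᶜ = comp₂ universalᶜ (constᶜ pt) (comp₁ gᶜ π₁)

  li : ℕ
  li = proj₁ (proj₁ (proj₂ (φ-smn liᶜ)) 0)

  li-spec : ∀ m j → Eval liᶜ (0 ∷ m ∷ []) j ⇔ φ li m j
  li-spec = proj₂ (proj₂ (φ-smn liᶜ)) 0 li (proj₂ (proj₁ (proj₂ (φ-smn liᶜ)) 0))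

  li-inversion : ∀ m j → φ li m j → ∃ λ idx → Eval gᶜ (m ∷ []) idx × φ pt idx j
  li-inversion m j p with from (li-spec m j) p
  ... | ev-comp (ev-∷ eval-pt (ev-∷ (ev-comp (ev-∷ (ev-proj _) ev-[]) eval-idx) ev-[])) eval-u
    with eval-functional eval-pt (eval-const pt)
  ...   | refl = _ , eval-idx , from (proj₂ φ-universal pt _ j) eval-u

  module ForSequence (m : ℕ) (s : ℕ → T) (in-Seq : Seq s) (ix : IsIndex S m s) (cv : Convergent S s) where
    open NormedEnumeration S (proj₁ acc) pce m s ix (only-monotone s in-Seq)

    y : T
    y = proj₁ (maximal s in-Seq cv)

    y-limit : Lim S s y
    y-limit = proj₁ (proj₂ (maximal s in-Seq cv))

    y-greatest : ∀ z → Lim S s z → _≤τ_ S z y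
    y-greatest = proj₂ (proj₂ (maximal s in-Seq cv))

    reached⇔nbhd : ∀ n → Reached n ⇔ B n y
    reached⇔nbhd n = mk⇔ (λ (a , h) → y-greatest (s a) (monotone-term-limit s (only-monotone s in-Seq) a) n h)
                         (λ h → let (N , late) = y-limit n h in N , late N ≤-refl)

    li-value : ∀ j → φ li m j → X j y
    li-value j p =
      let (idx , eval-idx , φ-pt) = li-inversion m j p
          (j₀ , φ-pt₀ , x-j₀) = pt-limit idx y (converges y reached⇔nbhd idx (g-enumeration m idx eval-idx))
      in subst (λ i → X i y) (φ-functional φ-pt₀ φ-pt) x-j₀

    li-defined : ∃ λ j → φ li m j
    li-defined =
      let (idx , eval-idx) = g-total m
          (j , φ-pt , _) = pt-limit idx y (converges y reached⇔nbhd idx (g-enumeration m idx eval-idx))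
      in j , to (li-spec m j) (eval-comp₂ (eval-const pt) (eval-comp₁ (ev-proj (# 1)) eval-idx)
                                          (to (proj₂ φ-universal pt idx j) φ-pt))

    y-final : ∀ ā → (∀ a → ā ≤ a → s a ≡ s ā) → y ≡ s ā
    y-final ā constant = ≤τ-antisym y (s ā) y≤final (y-greatest (s ā) (monotone-term-limit s (only-monotone s in-Seq) ā))
      where
        y≤final : _≤τ_ S y (s ā)
        y≤final n h = let (N , late) = y-limit n h in subst (B n) (constant (N ⊔ ā) (m≤n⊔m N ā)) (late (N ⊔ ā) (m≤m⊔n N ā))

  limit-found : ∀ m s → Seq s → IsIndex S m s → Convergent S s →
                ∃ λ j → φ li m j × ∃ λ y → X j y × Lim S s y × (∀ ā → (∀ a → ā ≤ a → s a ≡ s ā) → y ≡ s ā)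
  limit-found m s in-Seq ix cv =
    let (j , φ-li) = li-defined in j , φ-li , y , li-value j φ-li , y-limit , y-final
    where open ForSequence m s in-Seq ix cv

  -- property (iv): sequences with the same limits have the same greatest limit
  limit-invariant : ∀ m m' s s' → Seq s → IsIndex S m s → Convergent S s →
                    Seq s' → IsIndex S m' s' → Convergent S s' → (∀ y → Lim S s y ⇔ Lim S s' y) →
                    ∀ j j' y y' → φ li m j → φ li m' j' → X j y → X j' y' → y ≡ y'
  limit-invariant m m' s s' in-Seq ix cv in-Seq' ix' cv' same-limits j j' z z' φ-li φ-li' x-j x-j' =
    begin
      z      ≡⟨ X-functional j z A.y x-j (A.li-value j φ-li) ⟩
      A.y    ≡⟨ ≤τ-antisym A.y B.y (B.y-greatest A.y (to (same-limits A.y) A.y-limit))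
                                   (A.y-greatest B.y (from (same-limits B.y) B.y-limit)) ⟩
      B.y    ≡⟨ X-functional j' z' B.y x-j' (B.li-value j' φ-li') ⟨
      z'     ∎
    where
      open ≡-Reasoning
      module A = ForSequence m s in-Seq ix cv
      module B = ForSequence m' s' in-Seq' ix' cv'

-- Proposition 5.11.
proposition5p11 : (S : Space) (Q : SeqSystem S) →
    OnlyMonotone S Q → MaximalLimits S Q →
    Acceptable S → ≺-CE S → EnumerableStrongBases S →
    LimitAlgorithm S Q
proposition5p11 S Q only-monotone maximal acc pce _ = li , limit-found , limit-invariant
  where open LimitAlgorithmConstruction S Q only-monotone maximal acc pce
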